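{- Let $G_1$ be the ladder graph defined below, and let $S_1=\{\ell_1,\ell_3,\ell_5,r_1,r_3,r_5\}$ and $S_7=\{\ell_2,\ell_4,\ell_6,r_2,r_4,r_6\}$. Then $S_1$ and $S_7$ are dominating sets of $G_1$, $\gamma(G_1)=6$, and in $D_{\gamma(G_1)+1}(G_1)$ there is exactly one path (reconfiguration sequence without repeated dominating sets) between $S_1$ and $S_7$, and it has length $12$.
   Context: A set $S\subseteq V(G)$ is a dominating set of $G$ if every vertex of $V(G)\setminus S$ is adjacent to a vertex of $S$; $\gamma(G)$ is the minimum cardinality of a dominating set of $G$. For a positive integer $k$, the $k$-dominating graph $D_k(G)$ has as vertices the dominating sets of $G$ of cardinality at most $k$, two such sets being adjacent iff their symmetric difference consists of exactly one vertex of $G$; a reconfiguration sequence is a walk in $D_k(G)$. Linking two vertices $x,y$ by a linkage gadget means adding the edge $\{x,y\}$ together with three new vertices (internal vertices), each adjacent exactly to $x$ and $y$. The ladder $G_1$ has twelve ladder vertices $\ell_1,\dots,\ell_6,r_1,\dots,r_6$, and for each of the following fifteen pairs a linkage gadget (with its own three internal vertices) linking the pair: the vertical pairs $\{\ell_i,\ell_{i+1}\}$ and $\{r_i,r_{i+1}\}$ for $1\le i\le 5$, and the cross pairs $\{\ell_{i+1},r_i\}$ for $1\le i\le 5$. There are no other vertices or edges (so $G_1$ has $57$ vertices). -}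

module Defs where

open import Data.Nat using (ℕ; _≤_)
open import Data.Fin using (Fin; zero; suc; _↑ˡ_; _↑ʳ_; inject₁; combine)
open import Data.Fin.Subset using (Subset; _∈_; _∪_; _─_; ⁅_⁆; ∣_∣; ⊥)
open import Data.List using (List; []; _∷_; foldr; head; last; length)
open import Data.List.Relation.Unary.All using (All)
open import Data.List.Relation.Unary.Unique.Propositional using (Unique)
open import Data.List.Relation.Unary.Linked using (Linked)
open import Data.Maybe using (just)
open import Data.Product using (Σ; _×_; ∃)
open import Data.Sum using (_⊎_)
open import Relation.Binary.PropositionalEquality using (_≡_)

-- Generic notions for a graph on vertex set Fin n given by an adjacency
-- relation Adj (assumed symmetric by the caller).

Dominating : ∀ {n} → (Fin n → Fin n → Set) → Subset n → Set
Dominating {n} Adj S = ∀ (v : Fin n) → v ∈ S ⊎ Σ (Fin n) (λ u → u ∈ S × Adj v u)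

DominationNumber : ∀ {n} → (Fin n → Fin n → Set) → ℕ → Set
DominationNumber {n} Adj g =
  Σ (Subset n) (λ S → Dominating Adj S × ∣ S ∣ ≡ g)
  × (∀ (S : Subset n) → Dominating Adj S → g ≤ ∣ S ∣)

DkVertex : ∀ {n} → (Fin n → Fin n → Set) → ℕ → Subset n → Set
DkVertex Adj k S = Dominating Adj S × ∣ S ∣ ≤ k

SymDiffSingleton : ∀ {n} → Subset n → Subset n → Set
SymDiffSingleton {n} S T = Σ (Fin n) (λ v → (S ─ T) ∪ (T ─ S) ≡ ⁅ v ⁆)

-- Its length (number of edges) is
-- (length of list) - 1.
IsDkPath : ∀ {n} → (Fin n → Fin n → Set) → ℕ → Subset n → Subset n
         → List (Subset n) → Set
IsDkPath Adj k S T xs =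
  head xs ≡ just S × last xs ≡ just T
  × All (DkVertex Adj k) xs
  × Linked SymDiffSingleton xs
  × Unique xs

-- The ladder G₁ on 57 vertices.
-- Numbering: ℓ_{i+1} = i (i < 6), r_{i+1} = 6 + i, and the internal
-- vertices of the gadgets occupy 12 .. 56.

V : Set
V = Fin 57

ℓ : Fin 6 → V
ℓ i = i ↑ˡ 51

r : Fin 6 → V
r i = 6 ↑ʳ (i ↑ˡ 45)

-- 15 gadgets, indexed by a kind (Fin 3) and a position i (Fin 5, i.e. 1..5):
--   kind 0 : {ℓ_i , ℓ_{i+1}}   kind 1 : {r_i , r_{i+1}}   kind 2 : {ℓ_{i+1} , r_i}
end₁ : Fin 3 → Fin 5 → V
end₁ zero i = ℓ (inject₁ i)
end₁ (suc zero) i = r (inject₁ i)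
end₁ (suc (suc zero)) i = ℓ (suc i)

end₂ : Fin 3 → Fin 5 → V
end₂ zero i = ℓ (suc i)
end₂ (suc zero) i = r (suc i)
end₂ (suc (suc zero)) i = r (inject₁ i)

inner : Fin 3 → Fin 5 → Fin 3 → V
inner k i j = 12 ↑ʳ combine (combine k i) j

data Edge : V → V → Set where
  link : ∀ k i → Edge (end₁ k i) (end₂ k i)
  int₁ : ∀ k i j → Edge (inner k i j) (end₁ k i)
  int₂ : ∀ k i j → Edge (inner k i j) (end₂ k i)

Adj₁ : V → V → Set
Adj₁ x y = Edge x y ⊎ Edge y x

fromList : List V → Subset 57
fromList = foldr (λ v S → ⁅ v ⁆ ∪ S) ⊥

S₁ : Subset 57
S₁ = fromList (ℓ zero ∷ ℓ (suc (suc zero)) ∷ ℓ (suc (suc (suc (suc zero))))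
             ∷ r zero ∷ r (suc (suc zero)) ∷ r (suc (suc (suc (suc zero)))) ∷ [])

S₇ : Subset 57
S₇ = fromList (ℓ (suc zero) ∷ ℓ (suc (suc (suc zero))) ∷ ℓ (suc (suc (suc (suc (suc zero)))))
             ∷ r (suc zero) ∷ r (suc (suc (suc zero))) ∷ r (suc (suc (suc (suc (suc zero))))) ∷ [])

-- A gadget's internal vertices see only its two ends, so a dominating set of G₁ contains an
-- end of every gadget or all its internal vertices. The gadgets on the six rungs {ℓ₁,ℓ₂}, {ℓ₃,ℓ₄},
-- {ℓ₅,ℓ₆}, {r₁,r₂}, {r₃,r₄}, {r₅,r₆} are vertex-disjoint, whence γ(G₁) = 6. A path in D₇(G₁)
-- leaving a minimum dominating set M must therefore add a vertex v and then remove some w ≠ v.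
-- If a gadget joins w to a vertex z ∉ M with z ≠ v, its internal vertices are left undominated.
-- On each of the seven minimum sets met on the way from S₁ to S₇ (one of ℓ₁, r₁, ℓ₃, r₃, ℓ₅, r₅
-- moving one rung up at a time) this leaves a single exchange that does not lead back to the
-- previous minimum set, which is checked by computation.
module Submission where

open import Defs
open import Data.Bool using (Bool; true; false; not)
open import Data.Bool.Properties using (not-involutive) renaming (_≟_ to _≟ᵇ_)
open import Data.Empty using (⊥-elim)
open import Data.Fin using (Fin; zero; suc; combine; #_)
open import Data.Fin.Properties using (_≟_; all?; any?; ↑ʳ-injective; combine-injective)
open import Data.Fin.Subset using (Subset; _∈_; _∪_; _─_; ⁅_⁆; ∣_∣) renaming (⊥ to ∅)
open import Data.List using (List; []; _∷_; last; length; map)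
open import Data.List.Membership.Propositional using (find; lose) renaming (_∈_ to _∈ₗ_)
open import Data.List.Relation.Unary.All as All using (All; []; _∷_)
open import Data.List.Relation.Unary.All.Properties using (map⁺)
open import Data.List.Relation.Unary.AllPairs using (AllPairs; []; _∷_; allPairs?)
open import Data.List.Relation.Unary.Any using (Any; here; there)
open import Data.List.Relation.Unary.Linked using (Linked; [-]; _∷_)
open import Data.List.Relation.Unary.Unique.Propositional using (Unique)
open import Data.Maybe using (just)
open import Data.Maybe.Properties using (just-injective)
open import Data.Nat using (ℕ; suc; _≤_; _≤?_; z≤n; s≤s)
open import Data.Nat.Properties using (suc-injective; <⇒≱; ≤-reflexive; <-irrefl; 1+n≢n)
open import Data.Product using (Σ; Σ-syntax; ∃; _×_; _,_; proj₁)
open import Data.Sum using (_⊎_; inj₁; inj₂; [_,_]′; swap)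
open import Function using (_∘_)
open import Data.Vec using ([]; _∷_; lookup; updateAt) renaming (tail to tailᵥ)
open import Data.Vec.Properties
  using ([]=⇒lookup; lookup⇒[]=; lookup∘updateAt; lookup∘updateAt′; updateAt-updateAt-local; updateAt-id; ≡-dec)
open import Relation.Nullary using (¬_; Dec; yes; no; contradiction)
open import Relation.Nullary.Decidable using (from-yes; _×-dec_; _⊎-dec_; _→-dec_; ¬?)
open import Relation.Binary.PropositionalEquality using (_≡_; _≢_; refl; sym; trans; cong; subst)
import Data.List.Relation.Unary.Unique.DecPropositional as UniqueDec

flip : ∀ {n} → Fin n → Subset n → Subset n
flip v S = updateAt S v not

flip-involutive : ∀ {n} (v : Fin n) S → flip v (flip v S) ≡ S
flip-involutive v S = trans (updateAt-updateAt-local v S (not-involutive (lookup S v))) (updateAt-id v S)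

flip-other : ∀ {n} {v x : Fin n} S → x ≢ v → lookup (flip v S) x ≡ lookup S x
flip-other {v = v} {x} S x≢v = lookup∘updateAt′ x v x≢v S

∣flip∣-inside : ∀ {n} (v : Fin n) S → lookup S v ≡ true → ∣ S ∣ ≡ suc ∣ flip v S ∣
∣flip∣-inside zero    (true ∷ S)  refl = refl
∣flip∣-inside (suc v) (false ∷ S) Sv   = ∣flip∣-inside v S Sv
∣flip∣-inside (suc v) (true ∷ S)  Sv   = cong suc (∣flip∣-inside v S Sv)

∣flip∣-outside : ∀ {n} (v : Fin n) S → lookup S v ≡ false → ∣ flip v S ∣ ≡ suc ∣ S ∣
∣flip∣-outside zero    (false ∷ S) refl = refl
∣flip∣-outside (suc v) (false ∷ S) Sv   = ∣flip∣-outside v S Sv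
∣flip∣-outside (suc v) (true ∷ S)  Sv   = cong suc (∣flip∣-outside v S Sv)

lookup⇒∈ : ∀ {n} {S : Subset n} {x} → lookup S x ≡ true → x ∈ S
lookup⇒∈ = lookup⇒[]= _ _

_△_ : ∀ {n} → Subset n → Subset n → Subset n
S △ T = (S ─ T) ∪ (T ─ S)

△-self : ∀ {n} (S : Subset n) → S △ S ≡ ∅
△-self []          = refl
△-self (false ∷ S) = cong (false ∷_) (△-self S)
△-self (true ∷ S)  = cong (false ∷_) (△-self S)

△≡∅⇒≡ : ∀ {n} (S T : Subset n) → S △ T ≡ ∅ → T ≡ S
△≡∅⇒≡ []          []          _  = refl
△≡∅⇒≡ (false ∷ S) (false ∷ T) eq = cong (false ∷_) (△≡∅⇒≡ S T (cong tailᵥ eq))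
△≡∅⇒≡ (true ∷ S)  (true ∷ T)  eq = cong (true ∷_) (△≡∅⇒≡ S T (cong tailᵥ eq))
△≡∅⇒≡ (false ∷ S) (true ∷ T)  ()
△≡∅⇒≡ (true ∷ S)  (false ∷ T) ()

△-flip : ∀ {n} (v : Fin n) S → S △ flip v S ≡ ⁅ v ⁆
△-flip zero    (false ∷ S) = cong (true ∷_) (△-self S)
△-flip zero    (true ∷ S)  = cong (true ∷_) (△-self S)
△-flip (suc v) (false ∷ S) = cong (false ∷_) (△-flip v S)
△-flip (suc v) (true ∷ S)  = cong (false ∷_) (△-flip v S)

△≡⁅⁆⇒flip : ∀ {n} (S T : Subset n) v → S △ T ≡ ⁅ v ⁆ → T ≡ flip v S
△≡⁅⁆⇒flip (false ∷ S) (true ∷ T)  zero    eq = cong (true ∷_) (△≡∅⇒≡ S T (cong tailᵥ eq))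
△≡⁅⁆⇒flip (true ∷ S)  (false ∷ T) zero    eq = cong (false ∷_) (△≡∅⇒≡ S T (cong tailᵥ eq))
△≡⁅⁆⇒flip (false ∷ S) (false ∷ T) zero    ()
△≡⁅⁆⇒flip (true ∷ S)  (true ∷ T)  zero    ()
△≡⁅⁆⇒flip (false ∷ S) (false ∷ T) (suc v) eq = cong (false ∷_) (△≡⁅⁆⇒flip S T v (cong tailᵥ eq))
△≡⁅⁆⇒flip (true ∷ S)  (true ∷ T)  (suc v) eq = cong (true ∷_) (△≡⁅⁆⇒flip S T v (cong tailᵥ eq))
△≡⁅⁆⇒flip (false ∷ S) (true ∷ T)  (suc v) ()
△≡⁅⁆⇒flip (true ∷ S)  (false ∷ T) (suc v) ()

exchange : ∀ {n} → Fin n → Fin n → Subset n → Subset n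
exchange v w S = flip w (flip v S)

module _ {n} {M : Subset n} {v w : Fin n} (v∉M : lookup M v ≡ false) (w∈M : lookup M w ≡ true) where

  private
    outside≢w : ∀ {x} → lookup M x ≡ false → x ≢ w
    outside≢w Mx refl with trans (sym Mx) w∈M
    ... | ()

    w∈M+v : lookup (flip v M) w ≡ true
    w∈M+v = trans (flip-other M (λ w≡v → outside≢w v∉M (sym w≡v))) w∈M

  exchange-removes : lookup (exchange v w M) w ≡ false
  exchange-removes = trans (lookup∘updateAt w (flip v M)) (cong not w∈M+v)

  exchange-outside : ∀ {x} → lookup M x ≡ false → lookup (exchange v w M) x ≡ true → x ≡ v
  exchange-outside {x} Mx Yx with x ≟ v
  ... | yes x≡v = x≡v
  ... | no x≢v with trans (sym Yx) (trans (flip-other (flip v M) (outside≢w Mx)) (trans (flip-other M x≢v) Mx))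
  ...   | ()

  ∣exchange∣ : ∣ exchange v w M ∣ ≡ ∣ M ∣
  ∣exchange∣ = suc-injective (trans (sym (∣flip∣-inside w (flip v M) w∈M+v)) (∣flip∣-outside v M v∉M))

module _ {n} {Adj : Fin n → Fin n → Set} where

  dominating-meets : ∀ {S : Subset n} {N} x → Dominating Adj S → (∀ {u} → Adj x u → u ∈ₗ N) →
                     Any (λ y → lookup S y ≡ true) (x ∷ N)
  dominating-meets x dom nbrs with dom x
  ... | inj₁ x∈S             = here ([]=⇒lookup x∈S)
  ... | inj₂ (u , u∈S , x~u) = there (lose (nbrs x~u) ([]=⇒lookup u∈S))

  -- c can only be dominated by itself, by z, or by w, which the exchange removes.
  exchange-dominates : ∀ {M : Subset n} {v w z c} → lookup M v ≡ false → lookup M w ≡ true →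
                       lookup M z ≡ false → lookup M c ≡ false → (∀ {u} → Adj c u → u ≡ w ⊎ u ≡ z) →
                       Dominating Adj (exchange v w M) → v ≡ c ⊎ v ≡ z
  exchange-dominates {M} {c = c} v∉M w∈M z∉M c∉M c-nbrs dom with dom c
  ... | inj₁ c∈Y = inj₁ (sym (exchange-outside {M = M} v∉M w∈M c∉M ([]=⇒lookup c∈Y)))
  ... | inj₂ (u , u∈Y , c~u) with c-nbrs c~u
  ...   | inj₂ refl = inj₂ (sym (exchange-outside {M = M} v∉M w∈M z∉M ([]=⇒lookup u∈Y)))
  ...   | inj₁ refl with trans (sym ([]=⇒lookup u∈Y)) (exchange-removes {M = M} v∉M w∈M)
  ...     | ()

  exchange-pinned : ∀ {M : Subset n} {v w z a b} → lookup M v ≡ false → lookup M w ≡ true →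
                    lookup M z ≡ false → lookup M a ≡ false → lookup M b ≡ false → a ≢ b →
                    (∀ {u} → Adj a u → u ≡ w ⊎ u ≡ z) → (∀ {u} → Adj b u → u ≡ w ⊎ u ≡ z) →
                    Dominating Adj (exchange v w M) → v ≡ z
  exchange-pinned v∉M w∈M z∉M a∉M b∉M a≢b a-nbrs b-nbrs dom
    with exchange-dominates v∉M w∈M z∉M a∉M a-nbrs dom | exchange-dominates v∉M w∈M z∉M b∉M b-nbrs dom
  ... | inj₂ v≡z | _        = v≡z
  ... | inj₁ _   | inj₂ v≡z = v≡z
  ... | inj₁ v≡a | inj₁ v≡b = ⊥-elim (a≢b (trans (sym v≡a) v≡b))

Apart : ∀ {n} → List (Fin n) → List (Fin n) → Set
Apart B B′ = All (λ x → All (x ≢_) B′) B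

apart? : ∀ {n} (B B′ : List (Fin n)) → Dec (Apart B B′)
apart? B B′ = All.all? (λ x → All.all? (λ y → ¬? (x ≟ y)) B′) B

Meets : ∀ {n} → Subset n → List (Fin n) → Set
Meets S B = Any (λ x → lookup S x ≡ true) B

hitting-bound : ∀ {n} (S : Subset n) {Bs} → AllPairs Apart Bs → All (Meets S) Bs → length Bs ≤ ∣ S ∣
hitting-bound S []                  []               = z≤n
hitting-bound S {B ∷ Bs} (B-apart ∷ apart) (B-meets ∷ meets) with find B-meets
... | x , x∈B , x∈S =
  subst (suc (length Bs) ≤_) (sym (∣flip∣-inside x S x∈S))
    (s≤s (hitting-bound (flip x S) apart (All.zipWith still-meets (B-apart , meets))))
  where
  still-meets : ∀ {B′} → Apart B B′ × Meets S B′ → Meets (flip x S) B′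
  still-meets (B′-apart , B′-meets) with find B′-meets
  ... | y , y∈B′ , y∈S =
    lose y∈B′ (trans (flip-other S (λ y≡x → All.lookup (All.lookup B′-apart x∈B) y∈B′ (sym y≡x))) y∈S)

last-∈ : ∀ {A : Set} {y : A} xs → last xs ≡ just y → y ∈ₗ xs
last-∈ (x ∷ [])     refl = here refl
last-∈ (x ∷ x′ ∷ xs) eq   = there (last-∈ (x′ ∷ xs) eq)

exchangePath : ∀ {n} → Subset n → List (Fin n × Fin n) → List (Subset n)
exchangePath M []             = M ∷ []
exchangePath M ((v , w) ∷ ms) = M ∷ flip v M ∷ exchangePath (exchange v w M) ms

exchangePath-linked : ∀ {n} (M : Subset n) ms → Linked SymDiffSingleton (exchangePath M ms)
exchangePath-linked M []                 = [-]
exchangePath-linked M ((v , w) ∷ [])     = (v , △-flip v M) ∷ (w , △-flip w (flip v M)) ∷ [-]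
exchangePath-linked M ((v , w) ∷ m ∷ ms) =
  (v , △-flip v M) ∷ (w , △-flip w (flip v M)) ∷ exchangePath-linked (exchange v w M) (m ∷ ms)

module ForcedPaths {n} (Adj : Fin n → Fin n → Set) {g : ℕ}
                   (γ-bound : ∀ S → Dominating Adj S → g ≤ ∣ S ∣) (T : Subset n) (∣T∣≡g : ∣ T ∣ ≡ g) where

  D : Subset n → Set
  D = DkVertex Adj (suc g)

  private
    ∣added∣ : ∀ (M : Subset n) v → ∣ M ∣ ≡ g → lookup M v ≡ false → ∣ flip v M ∣ ≡ suc g
    ∣added∣ M v ∣M∣≡g M[v] = trans (∣flip∣-outside v M M[v]) (cong suc ∣M∣≡g)

  -- P is the minimum set visited just before M (M itself at the start of the path).
  data Forced (P M : Subset n) : List (Fin n × Fin n) → Set where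
    arrived : M ≡ T → Forced P M []
    forced  : ∀ {v₀ w₀ ms} → M ≢ T →
              (∀ v w → lookup M v ≡ false → lookup M w ≡ true → Dominating Adj (exchange v w M) →
                 P ≢ exchange v w M → v ≡ v₀ × w ≡ w₀) →
              Forced M (exchange v₀ w₀ M) ms → Forced P M ((v₀ , w₀) ∷ ms)

  leave-minimum : ∀ {M X} → ∣ M ∣ ≡ g → D X → SymDiffSingleton M X →
                  ∃ λ v → X ≡ flip v M × lookup M v ≡ false
  leave-minimum {M} {X} ∣M∣≡g (X-dom , _) (v , M△X) with △≡⁅⁆⇒flip M X v M△X | lookup M v in M[v]
  ... | refl | false = v , refl , M[v]
  ... | refl | true  =
    contradiction (γ-bound X X-dom) (<⇒≱ (≤-reflexive (trans (sym (∣flip∣-inside v M M[v])) ∣M∣≡g)))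

  return-to-minimum : ∀ {X Y} → ∣ X ∣ ≡ suc g → D Y → SymDiffSingleton X Y →
                      ∃ λ w → Y ≡ flip w X × lookup X w ≡ true
  return-to-minimum {X} {Y} ∣X∣≡1+g (_ , ∣Y∣≤1+g) (w , X△Y) with △≡⁅⁆⇒flip X Y w X△Y | lookup X w in X[w]
  ... | refl | true  = w , refl , X[w]
  ... | refl | false =
    contradiction (subst (_≤ suc g) (trans (∣flip∣-outside w X X[w]) (cong suc ∣X∣≡1+g)) ∣Y∣≤1+g) (<-irrefl refl)

  forced-path : ∀ {P M ms} → Forced P M ms → ∣ M ∣ ≡ g → ∀ rest →
                Linked SymDiffSingleton (M ∷ rest) → All D rest → Unique (M ∷ rest) → All (P ≢_) rest →
                last (M ∷ rest) ≡ just T → M ∷ rest ≡ exchangePath M ms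
  forced-path (arrived refl) _ []       _ _ _ _ _ = refl
  forced-path (arrived refl) _ (X ∷ rest) _ _ (T∉rest ∷ _) _ T-last =
    ⊥-elim (All.lookup T∉rest (last-∈ (X ∷ rest) T-last) refl)
  forced-path (forced M≢T _ _) _ [] _ _ _ _ M-last = ⊥-elim (M≢T (just-injective M-last))
  forced-path {M = M} (forced _ _ _) ∣M∣≡g (X ∷ []) (M~X ∷ [-]) (X-D ∷ []) _ _ X-last
    with leave-minimum ∣M∣≡g X-D M~X
  ... | v , refl , M[v] =
    ⊥-elim (1+n≢n (trans (sym (∣added∣ M v ∣M∣≡g M[v])) (trans (cong ∣_∣ (just-injective X-last)) ∣T∣≡g)))
  forced-path {M = M} (forced _ pinned next) ∣M∣≡g (X ∷ Y ∷ rest) (M~X ∷ X~Y ∷ links) (X-D ∷ Y-D ∷ Ds)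
              ((_ ∷ M≢Y ∷ M∉rest) ∷ _ ∷ unique) (_ ∷ P≢Y ∷ _) Y-last
    with leave-minimum ∣M∣≡g X-D M~X
  ... | v , refl , M[v] with return-to-minimum (∣added∣ M v ∣M∣≡g M[v]) Y-D X~Y
  ... | w , refl , X[w] with w ≟ v
  ...   | yes refl = ⊥-elim (M≢Y (sym (flip-involutive v M)))
  ...   | no w≢v with trans (sym (flip-other M w≢v)) X[w]
  ...     | M[w] with pinned v w M[v] M[w] (proj₁ Y-D) P≢Y
  ...       | refl , refl =
    cong (λ zs → M ∷ flip v M ∷ zs)
         (forced-path next (trans (∣exchange∣ {M = M} M[v] M[w]) ∣M∣≡g) rest links Ds unique M∉rest Y-last)

  unique-path : ∀ {M ms} → Forced M M ms → ∣ M ∣ ≡ g →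
                ∀ Q → IsDkPath Adj (suc g) M T Q → Q ≡ exchangePath M ms
  unique-path F ∣M∣≡g []         (() , _)
  unique-path F ∣M∣≡g (_ ∷ rest) (refl , T-last , _ ∷ Ds , links , unique@(M∉rest ∷ _)) =
    forced-path F ∣M∣≡g rest links Ds unique M∉rest T-last

end : Bool → Fin 3 → Fin 5 → V
end false = end₁
end true  = end₂

inner-injective : ∀ {k i j k′ i′ j′} → inner k i j ≡ inner k′ i′ j′ → k ≡ k′ × i ≡ i′ × j ≡ j′
inner-injective {k} {i} {j} {k′} {i′} {j′} eq
  with combine-injective (combine k i) j (combine k′ i′) j′ (↑ʳ-injective 12 _ _ eq)
... | ki≡k′i′ , refl with combine-injective k i k′ i′ ki≡k′i′
... | refl , refl = refl , refl , refl

inner≢end₁ : ∀ k i j k′ i′ → inner k i j ≢ end₁ k′ i′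
inner≢end₁ = from-yes (all? λ k → all? λ i → all? λ j → all? λ k′ → all? λ i′ →
  ¬? (inner k i j ≟ end₁ k′ i′))

inner≢end₂ : ∀ k i j k′ i′ → inner k i j ≢ end₂ k′ i′
inner≢end₂ = from-yes (all? λ k → all? λ i → all? λ j → all? λ k′ → all? λ i′ →
  ¬? (inner k i j ≟ end₂ k′ i′))

module _ (k : Fin 3) (i : Fin 5) (j : Fin 3) where

  private
    edge-from-inner : ∀ {x u} → Edge x u → x ≡ inner k i j → u ≡ end₁ k i ⊎ u ≡ end₂ k i
    edge-from-inner (link k′ i′)    eq = ⊥-elim (inner≢end₁ k i j k′ i′ (sym eq))
    edge-from-inner (int₁ k′ i′ j′) eq with inner-injective {k′} {i′} {j′} {k} {i} {j} eq
    ... | refl , refl , refl = inj₁ refl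
    edge-from-inner (int₂ k′ i′ j′) eq with inner-injective {k′} {i′} {j′} {k} {i} {j} eq
    ... | refl , refl , refl = inj₂ refl

    edge-to-inner : ∀ {x u} → Edge u x → x ≢ inner k i j
    edge-to-inner (link k′ i′)    eq = inner≢end₂ k i j k′ i′ (sym eq)
    edge-to-inner (int₁ k′ i′ j′) eq = inner≢end₁ k i j k′ i′ (sym eq)
    edge-to-inner (int₂ k′ i′ j′) eq = inner≢end₂ k i j k′ i′ (sym eq)

  inner-neighbours : ∀ s {u} → Adj₁ (inner k i j) u → u ≡ end s k i ⊎ u ≡ end (not s) k i
  inner-neighbours false (inj₁ e) = edge-from-inner e refl
  inner-neighbours true  (inj₁ e) = swap (edge-from-inner e refl)
  inner-neighbours _     (inj₂ e) = ⊥-elim (edge-to-inner e refl)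

opaque
  gadget-vertex : ∀ v → (Σ[ k ∈ Fin 3 ] Σ[ i ∈ Fin 5 ] (v ≡ end₁ k i ⊎ v ≡ end₂ k i))
                        ⊎ (Σ[ k ∈ Fin 3 ] Σ[ i ∈ Fin 5 ] Σ[ j ∈ Fin 3 ] v ≡ inner k i j)
  gadget-vertex = from-yes (all? λ v →
    (any? λ k → any? λ i → (v ≟ end₁ k i) ⊎-dec (v ≟ end₂ k i))
    ⊎-dec (any? λ k → any? λ i → any? λ j → v ≟ inner k i j))

GadgetCover : Subset 57 → Set
GadgetCover S = ∀ k i → lookup S (end₁ k i) ≡ true ⊎ lookup S (end₂ k i) ≡ true

gadgetCover? : ∀ S → Dec (GadgetCover S)
gadgetCover? S = all? λ k → all? λ i → (lookup S (end₁ k i) ≟ᵇ true) ⊎-dec (lookup S (end₂ k i) ≟ᵇ true)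

cover⇒dominating : ∀ S → GadgetCover S → Dominating Adj₁ S
cover⇒dominating S cover v with gadget-vertex v
... | inj₁ (k , i , inj₁ refl) =
  [ (λ e₁ → inj₁ (lookup⇒∈ e₁))
  , (λ e₂ → inj₂ (end₂ k i , lookup⇒∈ e₂ , inj₁ (link k i))) ]′ (cover k i)
... | inj₁ (k , i , inj₂ refl) =
  [ (λ e₁ → inj₂ (end₁ k i , lookup⇒∈ e₁ , inj₂ (link k i)))
  , (λ e₂ → inj₁ (lookup⇒∈ e₂)) ]′ (cover k i)
... | inj₂ (k , i , j , refl) =
  [ (λ e₁ → inj₂ (end₁ k i , lookup⇒∈ e₁ , inj₁ (int₁ k i j)))
  , (λ e₂ → inj₂ (end₂ k i , lookup⇒∈ e₂ , inj₁ (int₂ k i j))) ]′ (cover k i)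

-- The closed neighbourhood of the first internal vertex of gadget (k , i).
gadgetBlock : Fin 3 × Fin 5 → List V
gadgetBlock (k , i) = inner k i zero ∷ end₁ k i ∷ end₂ k i ∷ []

-- The gadgets on the rungs {ℓ₁,ℓ₂}, {ℓ₃,ℓ₄}, {ℓ₅,ℓ₆}, {r₁,r₂}, {r₃,r₄}, {r₅,r₆}.
rungGadgets : List (Fin 3 × Fin 5)
rungGadgets = (# 0 , # 0) ∷ (# 0 , # 2) ∷ (# 0 , # 4) ∷ (# 1 , # 0) ∷ (# 1 , # 2) ∷ (# 1 , # 4) ∷ []

γ₁-bound : ∀ S → Dominating Adj₁ S → 6 ≤ ∣ S ∣
γ₁-bound S dom = hitting-bound S
  (from-yes (allPairs? apart? (map gadgetBlock rungGadgets)))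
  (map⁺ (All.universal meets rungGadgets))
  where
  meets : ∀ ((k , i) : Fin 3 × Fin 5) → Meets S (gadgetBlock (k , i))
  meets (k , i) = dominating-meets (inner k i zero) dom
    λ adj → [ here , there ∘ here ]′ (inner-neighbours k i zero false adj)

inner₀≢inner₁ : ∀ k i → inner k i zero ≢ inner k i (suc zero)
inner₀≢inner₁ k i eq with inner-injective {k} {i} {zero} {k} {i} {suc zero} eq
... | _ , _ , ()

Obstruction : Subset 57 → V → V → Fin 3 → Fin 5 → Bool → Set
Obstruction M v w k i s =
  w ≡ end s k i × end (not s) k i ≢ v × lookup M (end (not s) k i) ≡ false
  × lookup M (inner k i zero) ≡ false × lookup M (inner k i (suc zero)) ≡ false

obstruction? : ∀ M v w k i s → Dec (Obstruction M v w k i s)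
obstruction? M v w k i s =
  (w ≟ end s k i) ×-dec ¬? (end (not s) k i ≟ v) ×-dec (lookup M (end (not s) k i) ≟ᵇ false)
  ×-dec (lookup M (inner k i zero) ≟ᵇ false) ×-dec (lookup M (inner k i (suc zero)) ≟ᵇ false)

obstructed : ∀ {M v w} k i s → Obstruction M v w k i s → lookup M v ≡ false → lookup M w ≡ true →
             ¬ Dominating Adj₁ (exchange v w M)
obstructed {M} k i s (refl , z≢v , z∉M , a∉M , b∉M) v∉M w∈M dom =
  z≢v (sym (exchange-pinned {M = M} v∉M w∈M z∉M a∉M b∉M (inner₀≢inner₁ k i)
                            (inner-neighbours k i zero s) (inner-neighbours k i (suc zero) s) dom))

_≟ˢ_ : ∀ {n} (S T : Subset n) → Dec (S ≡ T)
_≟ˢ_ = ≡-dec _≟ᵇ_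

ExchangeCertificate : Subset 57 → Subset 57 → V → V → Set
ExchangeCertificate P M v₀ w₀ = ∀ v w → lookup M v ≡ false → lookup M w ≡ true →
  (v ≡ v₀ × w ≡ w₀)
  ⊎ (Σ[ k ∈ Fin 3 ] Σ[ i ∈ Fin 5 ] (Obstruction M v w k i false ⊎ Obstruction M v w k i true))
  ⊎ P ≡ exchange v w M

exchangeCertificate? : ∀ P M v₀ w₀ → Dec (ExchangeCertificate P M v₀ w₀)
exchangeCertificate? P M v₀ w₀ = all? λ v → all? λ w →
  (lookup M v ≟ᵇ false) →-dec (lookup M w ≟ᵇ true) →-dec
    (((v ≟ v₀) ×-dec (w ≟ w₀))
     ⊎-dec (any? λ k → any? λ i → obstruction? M v w k i false ⊎-dec obstruction? M v w k i true)
     ⊎-dec (P ≟ˢ exchange v w M))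

Certificate : Subset 57 → Subset 57 → List (V × V) → Set
Certificate P M []               = M ≡ S₇
Certificate P M ((v₀ , w₀) ∷ ms) =
  M ≢ S₇ × ExchangeCertificate P M v₀ w₀ × Certificate M (exchange v₀ w₀ M) ms

certificate? : ∀ P M ms → Dec (Certificate P M ms)
certificate? P M []               = M ≟ˢ S₇
certificate? P M ((v₀ , w₀) ∷ ms) =
  ¬? (M ≟ˢ S₇) ×-dec exchangeCertificate? P M v₀ w₀ ×-dec certificate? M (exchange v₀ w₀ M) ms

open ForcedPaths Adj₁ γ₁-bound S₇ refl

certificate⇒forced : ∀ P M ms → Certificate P M ms → Forced P M ms
certificate⇒forced P M []               M≡S₇                 = arrived M≡S₇
certificate⇒forced P M ((v₀ , w₀) ∷ ms) (M≢S₇ , cert , rest) =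
  forced M≢S₇ pinned (certificate⇒forced M _ ms rest)
  where
  pinned : ∀ v w → lookup M v ≡ false → lookup M w ≡ true → Dominating Adj₁ (exchange v w M) →
           P ≢ exchange v w M → v ≡ v₀ × w ≡ w₀
  pinned v w v∉M w∈M dom P≢Y with cert v w v∉M w∈M
  ... | inj₁ prescribed                = prescribed
  ... | inj₂ (inj₁ (k , i , inj₁ ob)) = ⊥-elim (obstructed k i false ob v∉M w∈M dom)
  ... | inj₂ (inj₁ (k , i , inj₂ ob)) = ⊥-elim (obstructed k i true ob v∉M w∈M dom)
  ... | inj₂ (inj₂ P≡Y)               = ⊥-elim (P≢Y P≡Y)

-- Each pair (v , w) adds v and then removes w; ladder indices are 0-based, so ℓ (# 0) is ℓ₁.
moves : List (V × V)
moves = (ℓ (# 1) , ℓ (# 0)) ∷ (r (# 1) , r (# 0)) ∷ (ℓ (# 3) , ℓ (# 2)) ∷ (r (# 3) , r (# 2))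
      ∷ (ℓ (# 5) , ℓ (# 4)) ∷ (r (# 5) , r (# 4)) ∷ []

forced-moves : Forced S₁ S₁ moves
forced-moves = certificate⇒forced S₁ S₁ moves (from-yes (certificate? S₁ S₁ moves))

path : List (Subset 57)
path = exchangePath S₁ moves

lemma2 : Dominating Adj₁ S₁ × Dominating Adj₁ S₇ × DominationNumber Adj₁ 6
    × Σ (List (Subset 57)) (λ P → IsDkPath Adj₁ 7 S₁ S₇ P × length P ≡ 13
    × (∀ (Q : List (Subset 57)) → IsDkPath Adj₁ 7 S₁ S₇ Q → Q ≡ P))
lemma2 =
  S₁-dominating , S₇-dominating , ((S₁ , S₁-dominating , refl) , γ₁-bound)
  , path , (refl , refl , path-in-D₇ , exchangePath-linked S₁ moves , from-yes (unique? path)) , refl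
  , unique-path forced-moves refl
  where
  open UniqueDec _≟ˢ_ using (unique?)
  S₁-dominating : Dominating Adj₁ S₁
  S₁-dominating = cover⇒dominating S₁ (from-yes (gadgetCover? S₁))
  S₇-dominating : Dominating Adj₁ S₇
  S₇-dominating = cover⇒dominating S₇ (from-yes (gadgetCover? S₇))
  path-in-D₇ : All (DkVertex Adj₁ 7) path
  path-in-D₇ = All.map (λ (cover , small) → cover⇒dominating _ cover , small)
                       (from-yes (All.all? (λ S → gadgetCover? S ×-dec (∣ S ∣ ≤? 7)) path))
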